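{- Let $N\ge 2$ and let $A_1,A_2,\ldots$ be a quasifibonacci sequence of level $N$. Then for every positive integer $k$, \[\sum_{\substack{1\le i\le k-1\\ N\nmid i}}A_{k-i}<A_k .\]
   Context: For an integer $N\ge 2$, a sequence $A_1,A_2,\ldots$ of positive integers is a quasifibonacci sequence of level $N$ if $A_{k+N}=A_{k+N-1}+\cdots+A_k$ for all $k\ge 1$, and $A_k>A_{k-1}+\cdots+A_1$ for all $1\le k\le N$. -}

module Defs where

open import Data.Nat using (ℕ; zero; suc; _+_; _∸_; _≤_; _<_)
open import Data.Nat.Divisibility using (_∣_; _∣?_)
open import Data.Product using (_×_)
open import Relation.Binary.PropositionalEquality using (_≡_)
open import Relation.Nullary using (yes; no)

-- Sequences A₁, A₂, … are modelled as functions ℕ → ℕ; the value at 0 is ignored.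

windowSum : (ℕ → ℕ) → ℕ → ℕ → ℕ
windowSum A k zero    = 0
windowSum A k (suc n) = A k + windowSum A (suc k) n

prefixSum : (ℕ → ℕ) → ℕ → ℕ
prefixSum A zero    = 0
prefixSum A (suc m) = prefixSum A m + A (suc m)

record Quasifibonacci (N : ℕ) (A : ℕ → ℕ) : Set where
  field
    positive   : ∀ k → 1 ≤ k → 0 < A k
    recurrence : ∀ k → 1 ≤ k → A (k + N) ≡ windowSum A k N
    initial    : ∀ k → 1 ≤ k → k ≤ N → prefixSum A (k ∸ 1) < A k

skipSum : ℕ → (ℕ → ℕ) → ℕ → ℕ → ℕ
skipSum N A k zero    = 0
skipSum N A k (suc m) with N ∣? suc m
... | yes _ = skipSum N A k m
... | no  _ = skipSum N A k m + A (k ∸ suc m)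

module Submission where

-- Write N = n + 1 and let backSum A k m = A (k-1) + ⋯ + A (k-m) be
-- the m terms just below index k.
--  * For 1 ≤ k ≤ N no index i < k is a multiple of N, so the skipped sum is
--    the whole prefix A 1 + ⋯ + A (k-1), which is < A k by the initial
--    condition.
--  * Shifting k by N, the indices 1, …, N-1 contribute the block
--    backSum A (k+N) (N-1), the index N is skipped, and the remaining indices
--    reproduce the skipped sum at k (skipSum-shift).  The recurrence reads
--    A (k+N) = A k + backSum A (k+N) (N-1) (recurrence-back), so adding the
--    same block to both sides of the inequality at k gives it at k+N.
-- Strong induction on k combines the two cases.

open import Defs
open import Data.Nat using (ℕ; zero; suc; _+_; _≤_; _<_; _∸_; z≤n; s≤s; _≤?_)
open import Data.Nat.Properties
open import Data.Nat.Divisibility using (_∣_; _∣?_; ∣⇒≤; ∣-refl; ∣m∣n⇒∣m+n; ∣m+n∣m⇒∣n)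
open import Data.Nat.Induction using (<-rec)
open import Data.Product using (∃; _,_)
open import Data.Empty using (⊥-elim)
open import Relation.Nullary using (yes; no)
open import Relation.Binary.PropositionalEquality

backSum : (ℕ → ℕ) → ℕ → ℕ → ℕ
backSum A k zero    = 0
backSum A k (suc m) = backSum A k m + A (k ∸ suc m)

backSum-peel : ∀ A k m → backSum A (suc k) (suc m) ≡ A k + backSum A k m
backSum-peel A k zero    = +-comm 0 (A k)
backSum-peel A k (suc m) =
  trans (cong (_+ A (k ∸ suc m)) (backSum-peel A k m)) (+-assoc (A k) _ _)

backSum-prefix : ∀ A m → backSum A (suc m) m ≡ prefixSum A m
backSum-prefix A zero    = refl
backSum-prefix A (suc m) = begin
    backSum A (suc (suc m)) (suc m)  ≡⟨ backSum-peel A (suc m) m ⟩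
    A (suc m) + backSum A (suc m) m  ≡⟨ +-comm (A (suc m)) _ ⟩
    backSum A (suc m) m + A (suc m)  ≡⟨ cong (_+ A (suc m)) (backSum-prefix A m) ⟩
    prefixSum A m + A (suc m)        ∎
  where open ≡-Reasoning

windowSum-backSum : ∀ A j m → windowSum A j m ≡ backSum A (j + m) m
windowSum-backSum A j zero    = refl
windowSum-backSum A j (suc m) = begin
    A j + windowSum A (suc j) m              ≡⟨ cong (A j +_) (windowSum-backSum A (suc j) m) ⟩
    A j + backSum A (suc j + m) m            ≡⟨ +-comm (A j) _ ⟩
    backSum A (suc j + m) m + A j            ≡⟨ cong₂ (λ x y → backSum A x m + A y)
                                                      (sym (+-suc j m)) (sym (m+n∸n≡m j (suc m))) ⟩
    backSum A (j + suc m) m + A (j + suc m ∸ suc m) ∎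
  where open ≡-Reasoning

skipSum-below : ∀ N A k m → m < N → skipSum N A k m ≡ backSum A k m
skipSum-below N A k zero    m<N = refl
skipSum-below N A k (suc m) m<N with N ∣? suc m
... | yes N∣m = ⊥-elim (<⇒≱ m<N (∣⇒≤ N∣m))
... | no  _   = cong (_+ A (k ∸ suc m)) (skipSum-below N A k m (<-trans (n<1+n m) m<N))

module Level (n : ℕ) where

  -- The level, written so that it is visibly positive.
  N : ℕ
  N = suc n

  ∣+N⇒∣ : ∀ m → N ∣ m + N → N ∣ m
  ∣+N⇒∣ m N∣m+N = ∣m+n∣m⇒∣n (subst (N ∣_) (+-comm m N) N∣m+N) ∣-refl

  ∣⇒∣+N : ∀ m → N ∣ m → N ∣ m + N
  ∣⇒∣+N m N∣m = ∣m∣n⇒∣m+n N∣m ∣-refl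

  index-shift : ∀ k m → k + N ∸ (suc m + N) ≡ k ∸ suc m
  index-shift k m = begin
      k + N ∸ (suc m + N)   ≡⟨ cong₂ _∸_ (+-comm k N) (+-comm (suc m) N) ⟩
      N + k ∸ (N + suc m)   ≡⟨ [m+n]∸[m+o]≡n∸o N k (suc m) ⟩
      k ∸ suc m             ∎
    where open ≡-Reasoning

  skipSum-shift : ∀ A k m →
    skipSum N A (k + N) (m + N) ≡ backSum A (k + N) n + skipSum N A k m
  skipSum-shift A k zero with N ∣? N
  ... | yes _   = trans (skipSum-below N A (k + N) n ≤-refl) (sym (+-identityʳ _))
  ... | no  N∤N = ⊥-elim (N∤N ∣-refl)
  skipSum-shift A k (suc m) with N ∣? suc m + N | N ∣? suc m
  ... | yes _     | yes _     = skipSum-shift A k m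
  ... | yes N∣m+N | no  N∤m   = ⊥-elim (N∤m (∣+N⇒∣ (suc m) N∣m+N))
  ... | no  N∤m+N | yes N∣m   = ⊥-elim (N∤m+N (∣⇒∣+N (suc m) N∣m))
  ... | no  _     | no  _     = begin
      skipSum N A (k + N) (m + N) + A (k + N ∸ (suc m + N))
        ≡⟨ cong₂ _+_ (skipSum-shift A k m) (cong A (index-shift k m)) ⟩
      (backSum A (k + N) n + skipSum N A k m) + A (k ∸ suc m)
        ≡⟨ +-assoc (backSum A (k + N) n) _ _ ⟩
      backSum A (k + N) n + (skipSum N A k m + A (k ∸ suc m))
        ∎
    where open ≡-Reasoning

  above-level : ∀ {k} → N < k → ∃ λ i → suc i + N ≡ k
  above-level N<k with m≤n⇒∃[o]m+o≡n N<k
  ... | i , N+i+1≡k = i , trans (cong suc (+-comm i N)) N+i+1≡k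

  module Sequence (A : ℕ → ℕ) (Q : Quasifibonacci N A) where
    open Quasifibonacci Q

    recurrence-back : ∀ i → A (suc i + N) ≡ A (suc i) + backSum A (suc i + N) n
    recurrence-back i = begin
        A (suc i + N)                               ≡⟨ recurrence (suc i) (s≤s z≤n) ⟩
        A (suc i) + windowSum A (suc (suc i)) n     ≡⟨ cong (A (suc i) +_) (windowSum-backSum A (suc (suc i)) n) ⟩
        A (suc i) + backSum A (suc (suc i) + n) n   ≡⟨ cong (λ x → A (suc i) + backSum A (suc x) n) (sym (+-suc i n)) ⟩
        A (suc i) + backSum A (suc i + N) n         ∎
      where open ≡-Reasoning

    skipSum-base : ∀ i → suc i ≤ N → skipSum N A (suc i) i < A (suc i)
    skipSum-base i i<N = subst (_< A (suc i)) prefix≡skip (initial (suc i) (s≤s z≤n) i<N)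
      where
      prefix≡skip : prefixSum A i ≡ skipSum N A (suc i) i
      prefix≡skip = sym (trans (skipSum-below N A (suc i) i i<N) (backSum-prefix A i))

    -- Inductive step: the inequality at k implies the one at k+N, since both
    -- sides grow by the same block backSum A (k+N) (N-1).
    skipSum-step : ∀ i → skipSum N A (suc i) i < A (suc i) →
                   skipSum N A (suc i + N) (i + N) < A (suc i + N)
    skipSum-step i below = subst₂ _<_
      (sym (skipSum-shift A (suc i) i))
      (trans (+-comm _ (A (suc i))) (sym (recurrence-back i)))
      (+-monoʳ-< (backSum A (suc i + N) n) below)

    skipSum<term : ∀ k → 1 ≤ k → skipSum N A k (k ∸ 1) < A k
    skipSum<term = <-rec (λ k → 1 ≤ k → skipSum N A k (k ∸ 1) < A k) induct
      where
      induct : ∀ k → (∀ {j} → j < k → 1 ≤ j → skipSum N A j (j ∸ 1) < A j) →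
               1 ≤ k → skipSum N A k (k ∸ 1) < A k
      induct (suc i) ih _ with suc i ≤? N
      ... | yes k≤N = skipSum-base i k≤N
      ... | no  k≰N with above-level (≰⇒> k≰N)
      ...   | j , j+N≡k = subst (λ k → skipSum N A k (k ∸ 1) < A k) j+N≡k
                (skipSum-step j (ih j<k (s≤s z≤n)))
        where
        j<k : suc j < suc i
        j<k = subst (suc j <_) j+N≡k (m<m+n (suc j) (s≤s z≤n))

lemma2p1 : (N : ℕ) → 2 ≤ N → (A : ℕ → ℕ) → Quasifibonacci N A →
    (k : ℕ) → 1 ≤ k → skipSum N A k (k ∸ 1) < A k
lemma2p1 (suc n) _ A Q = Level.Sequence.skipSum<term n A Q
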